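{- Let $p$ be an odd prime, $n$ a positive integer with $\gcd(p,n)=1$ (equivalently, $x^p-x-1$ is irreducible in $\mathbb{F}_q[x]$), $q=p^n$, and let $b\in\mathbb{F}_q$ with $b\notin\mathbb{F}_{p^m}$ for every proper divisor $m$ of $n$. Let $i,j$ be integers with $0\le i,j\le np-1$ and $i\neq j$. Then $i+b^{p^i}\neq j+b^{p^j}$ in $\mathbb{F}_q$.
   Context: Integers $i,j$ are viewed as elements of $\mathbb{F}_q$ via the canonical map $\mathbb{Z}\to\mathbb{F}_p\subseteq\mathbb{F}_q$. For $m\mid n$, $\mathbb{F}_{p^m}$ is the subfield of $\mathbb{F}_q$ of order $p^m$. -}

module Defs where

open import Level using (Level; _⊔_; suc)
open import Algebra.Bundles using (CommutativeRing; Semiring)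
import Algebra.Definitions.RawSemiring as RS
open import Data.Nat using (ℕ)
open import Data.Fin using (Fin)
open import Data.Product using (Σ; ∃; _×_; _,_)
open import Relation.Nullary using (¬_)
open import Relation.Binary.PropositionalEquality using (_≡_)

module _ {c ℓ : Level} (R : CommutativeRing c ℓ) where
  open CommutativeRing R

  record IsField : Set (c ⊔ ℓ) where
    field
      1≉0 : ¬ (1# ≈ 0#)
      inv : ∀ x → ¬ (x ≈ 0#) → ∃ λ y → x * y ≈ 1#

  record HasCard (k : ℕ) : Set (c ⊔ ℓ) where
    field
      enum     : Fin k → Carrier
      enum-inj : ∀ i j → enum i ≈ enum j → i ≡ j
      enum-sur : ∀ x → ∃ λ i → enum i ≈ x

  record SubsetHasCard (S : Carrier → Set ℓ) (k : ℕ) : Set (c ⊔ ℓ) where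
    field
      enum     : Fin k → Carrier
      enum-in  : ∀ i → S (enum i)
      enum-inj : ∀ i j → enum i ≈ enum j → i ≡ j
      enum-sur : ∀ x → S x → ∃ λ i → enum i ≈ x

  record IsSubfield (S : Carrier → Set ℓ) : Set (c ⊔ ℓ) where
    field
      resp  : ∀ {x y} → x ≈ y → S x → S y
      has0  : S 0#
      has1  : S 1#
      +-cl  : ∀ {x y} → S x → S y → S (x + y)
      *-cl  : ∀ {x y} → S x → S y → S (x * y)
      neg-cl : ∀ {x} → S x → S (- x)
      inv-cl : ∀ {x y} → S x → ¬ (x ≈ 0#) → x * y ≈ 1# → S y

  ι : ℕ → Carrier
  ι n = RS._×_ (Semiring.rawSemiring semiring) n 1#

  _^ᴿ_ : Carrier → ℕ → Carrier
  x ^ᴿ n = RS._^_ (Semiring.rawSemiring semiring) x n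

{-# OPTIONS --safe #-}
-- Write σ k x = x ^ (p ^ k).  If i < j and i + σ i b = j + σ j b, put k = j - i and
-- c = σ i b: then σ k c = c + e with e = i - j in the prime field, so σ (k t) c = c + t e.
-- Since σ n is the identity of F and p ∤ n, this forces e = 0; hence i ≡ j (mod p), and c,
-- therefore b, is fixed by σ g for g = gcd k n.  If g < n, b lies in the subfield fixed by
-- σ g, which has p ^ g elements; if g = n, then n ∣ k < n p and p ∣ k, contradicting p ∤ n.
module Submission where

open import Level using (_⊔_)
open import Algebra.Bundles using (CommutativeRing)
open import Data.Empty using (⊥; ⊥-elim)
open import Data.Fin as Fin using (Fin; zero; suc)
import Data.Fin.Properties as Fin
open import Data.Fin.Permutation using (Permutation; permutation)
open import Data.Integer as ℤ using (ℤ; +_; -[1+_]; _⊖_)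
import Data.Integer.Properties as ℤ
open import Data.Maybe using (Maybe; just; nothing)
open import Data.Nat as ℕ using (ℕ; zero; suc; z≤n; s≤s; _≤_; _<_; _∸_; _!)
import Data.Nat.Properties as ℕ
open import Data.Nat.Combinatorics using (_C_; nCk≡n!/k![n-k]!; k![n∸k]!∣n!; nCk≡nC[n∸k]; nCn≡1)
open import Data.Nat.Coprimality using (Coprime; coprime-Bézout; prime⇒coprime)
open import Data.Nat.DivMod using (m/n*n≡m)
open import Data.Nat.Divisibility using (_∣_; divides; ∣⇒≤; m∣m*n)
open import Data.Nat.GCD using (module Bézout; gcd; gcd-GCD; gcd[m,n]∣m; gcd[m,n]∣n; gcd[m,n]≢0)
open import Data.Nat.Primality using (Prime; euclidsLemma; prime⇒nonTrivial; prime⇒nonZero)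
open import Data.Product using (∃; _×_; _,_; proj₁; proj₂)
open import Data.Sign as Sign using (Sign)
open import Data.Sum using (inj₁; inj₂; [_,_]′)
open import Relation.Binary.Definitions using (Decidable; Tri; tri<; tri≈; tri>)
open import Relation.Binary.PropositionalEquality as ≡ using (_≡_; _≢_)
open import Relation.Nullary using (¬_; Dec; yes; no)
import Relation.Unary as U
open import Algebra.Solver.Ring.AlmostCommutativeRing
  using (fromCommutativeRing; _-Raw-AlmostCommutative⟶_)
import Algebra.Properties.CommutativeMonoid.Sum as CommutativeMonoidSum
import Algebra.Properties.Monoid.Sum as MonoidSum
open import Defs
-- The ring solver needs coefficients with decidable equality; ℤ maps into every ring.
module IntegerCoefficientSolver {c ℓ} (R : CommutativeRing c ℓ) where
  open CommutativeRing R hiding (zero)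
  open import Relation.Binary.Reasoning.Setoid setoid
  open import Algebra.Properties.Semiring.Mult semiring using (×1-homo-*)
  open import Algebra.Properties.Monoid.Mult +-monoid using (×-homo-+)
  open import Algebra.Properties.Ring ring using (-1*x≈-x)
  open import Algebra.Properties.AbelianGroup +-abelianGroup using (⁻¹-∙-comm)
  open import Algebra.Properties.Group +-group using (⁻¹-involutive; ε⁻¹≈ε)

  private
    ⟦_⟧ : ℤ → Carrier
    ⟦ + n ⟧      = ι R n
    ⟦ -[1+ n ] ⟧ = - ι R (suc n)

    ⊖-homo : ∀ m n → ⟦ m ⊖ n ⟧ ≈ ι R m - ι R n
    ⊖-homo m zero = begin
      ⟦ m ⊖ 0 ⟧      ≡⟨ ≡.cong ⟦_⟧ (ℤ.⊖-≥ {m} z≤n) ⟩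
      ι R m          ≈⟨ sym (+-identityʳ _) ⟩
      ι R m + 0#     ≈⟨ +-congˡ (sym ε⁻¹≈ε) ⟩
      ι R m - 0#     ∎
    ⊖-homo zero (suc n) = begin
      ⟦ 0 ⊖ suc n ⟧    ≡⟨ ≡.cong ⟦_⟧ (ℤ.⊖-< {0} {suc n} (s≤s z≤n)) ⟩
      - ι R (suc n)    ≈⟨ sym (+-identityˡ _) ⟩
      0# - ι R (suc n) ∎
    ⊖-homo (suc m) (suc n) = begin
      ⟦ suc m ⊖ suc n ⟧                 ≡⟨ ≡.cong ⟦_⟧ (ℤ.[1+m]⊖[1+n]≡m⊖n m n) ⟩
      ⟦ m ⊖ n ⟧                         ≈⟨ ⊖-homo m n ⟩
      ι R m - ι R n                     ≈⟨ shift (ι R m) (ι R n) ⟩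
      ι R (suc m) - ι R (suc n)         ∎
      where
      shift : ∀ a b → a - b ≈ (1# + a) - (1# + b)
      shift a b = begin
        a - b                    ≈⟨ +-congˡ (sym (+-identityˡ (- b))) ⟩
        a + (0# - b)             ≈⟨ +-congˡ (+-congʳ (sym (-‿inverseʳ 1#))) ⟩
        a + ((1# - 1#) - b)      ≈⟨ +-congˡ (+-assoc 1# (- 1#) (- b)) ⟩
        a + (1# + (- 1# - b))    ≈⟨ sym (+-assoc a 1# _) ⟩
        (a + 1#) + (- 1# - b)    ≈⟨ +-cong (+-comm a 1#) (⁻¹-∙-comm 1# b) ⟩
        (1# + a) - (1# + b)      ∎

    +-homo : ∀ x y → ⟦ x ℤ.+ y ⟧ ≈ ⟦ x ⟧ + ⟦ y ⟧
    +-homo (+ m)    (+ n)    = ×-homo-+ 1# m n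
    +-homo (+ m)    -[1+ n ] = ⊖-homo m (suc n)
    +-homo -[1+ m ] (+ n)    = trans (⊖-homo n (suc m)) (+-comm _ _)
    +-homo -[1+ m ] -[1+ n ] = begin
      - ι R (suc (suc (m ℕ.+ n)))    ≡⟨ ≡.cong (λ k → - ι R k) (≡.sym (ℕ.+-suc (suc m) n)) ⟩
      - ι R (suc m ℕ.+ suc n)        ≈⟨ -‿cong (×-homo-+ 1# (suc m) (suc n)) ⟩
      - (ι R (suc m) + ι R (suc n))  ≈⟨ sym (⁻¹-∙-comm _ _) ⟩
      - ι R (suc m) - ι R (suc n)    ∎

    sign : Sign → Carrier
    sign Sign.+ = 1#
    sign Sign.- = - 1#

    ◃-homo : ∀ s n → ⟦ s ℤ.◃ n ⟧ ≈ sign s * ι R n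
    ◃-homo Sign.+ zero    = sym (zeroʳ _)
    ◃-homo Sign.- zero    = sym (zeroʳ _)
    ◃-homo Sign.+ (suc n) = sym (*-identityˡ _)
    ◃-homo Sign.- (suc n) = sym (-1*x≈-x _)

    sign-homo : ∀ s t → sign (s Sign.* t) ≈ sign s * sign t
    sign-homo Sign.+ _      = sym (*-identityˡ _)
    sign-homo Sign.- Sign.+ = sym (*-identityʳ _)
    sign-homo Sign.- Sign.- = sym (trans (-1*x≈-x (- 1#)) (⁻¹-involutive 1#))

    sign◃abs : ∀ x → ⟦ x ⟧ ≈ sign (ℤ.sign x) * ι R ℤ.∣ x ∣
    sign◃abs (+ n)    = sym (*-identityˡ _)
    sign◃abs -[1+ n ] = sym (-1*x≈-x _)

    *-homo : ∀ x y → ⟦ x ℤ.* y ⟧ ≈ ⟦ x ⟧ * ⟦ y ⟧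
    *-homo x y = begin
      ⟦ x ℤ.* y ⟧                          ≈⟨ ◃-homo (s Sign.* t) (a ℕ.* b) ⟩
      sign (s Sign.* t) * ι R (a ℕ.* b)    ≈⟨ *-cong (sign-homo s t) (×1-homo-* a b) ⟩
      (sign s * sign t) * (ι R a * ι R b)  ≈⟨ interchange ⟩
      (sign s * ι R a) * (sign t * ι R b)  ≈⟨ sym (*-cong (sign◃abs x) (sign◃abs y)) ⟩
      ⟦ x ⟧ * ⟦ y ⟧                        ∎
      where
      s = ℤ.sign x
      t = ℤ.sign y
      a = ℤ.∣ x ∣
      b = ℤ.∣ y ∣
      interchange : (sign s * sign t) * (ι R a * ι R b) ≈ (sign s * ι R a) * (sign t * ι R b)
      interchange = begin
        (sign s * sign t) * (ι R a * ι R b)  ≈⟨ *-assoc _ _ _ ⟩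
        sign s * (sign t * (ι R a * ι R b))  ≈⟨ *-congˡ (sym (*-assoc _ _ _)) ⟩
        sign s * ((sign t * ι R a) * ι R b)  ≈⟨ *-congˡ (*-congʳ (*-comm _ _)) ⟩
        sign s * ((ι R a * sign t) * ι R b)  ≈⟨ *-congˡ (*-assoc _ _ _) ⟩
        sign s * (ι R a * (sign t * ι R b))  ≈⟨ sym (*-assoc _ _ _) ⟩
        (sign s * ι R a) * (sign t * ι R b)  ∎

    -‿homo : ∀ x → ⟦ ℤ.- x ⟧ ≈ - ⟦ x ⟧
    -‿homo (+ zero)  = sym ε⁻¹≈ε
    -‿homo (+ suc n) = refl
    -‿homo -[1+ n ]  = sym (⁻¹-involutive _)

    homomorphism : ℤ.+-*-rawRing -Raw-AlmostCommutative⟶ fromCommutativeRing R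
    homomorphism = record
      { ⟦_⟧ = ⟦_⟧ ; +-homo = +-homo ; *-homo = *-homo ; -‿homo = -‿homo
      ; 0-homo = refl ; 1-homo = +-identityʳ 1# }

    coefficient≟ : ∀ x y → Maybe (⟦ x ⟧ ≈ ⟦ y ⟧)
    coefficient≟ x y with x ℤ.≟ y
    ... | yes ≡.refl = just refl
    ... | no _       = nothing

  open import Algebra.Solver.Ring ℤ.+-*-rawRing (fromCommutativeRing R) homomorphism coefficient≟
    public using (solve; con; _:+_; _:*_; _:-_; :-_; _:=_)

prime>1 : ∀ {p} → Prime p → 1 < p
prime>1 {p} p-prime = ℕ.nonTrivial⇒n>1 p {{prime⇒nonTrivial p-prime}}

prime∤! : ∀ {p} → Prime p → ∀ m → m < p → ¬ p ∣ m !
prime∤! p-prime zero    _   p∣1 = ℕ.≤⇒≯ (∣⇒≤ p∣1) (prime>1 p-prime)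
prime∤! p-prime (suc m) m<p p∣m! with euclidsLemma (suc m) (m !) p-prime p∣m!
... | inj₁ p∣1+m = ℕ.≤⇒≯ (∣⇒≤ p∣1+m) m<p
... | inj₂ p∣m!  = prime∤! p-prime m (ℕ.<-trans (ℕ.n<1+n m) m<p) p∣m!

prime∣pCk : ∀ {p} → Prime p → ∀ k → 0 < k → k < p → p ∣ p C k
prime∣pCk {p} p-prime k 0<k k<p
  with euclidsLemma (p C k) (k ! ℕ.* (p ∸ k) !) p-prime p∣C*k!*[p∸k]!
  where
  instance _ = k ℕ.!* (p ∸ k) !≢0
  p! : (p C k) ℕ.* (k ! ℕ.* (p ∸ k) !) ≡ p !
  p! = ≡.trans (≡.cong (ℕ._* (k ! ℕ.* (p ∸ k) !)) (nCk≡n!/k![n-k]! (ℕ.<⇒≤ k<p)))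
               (m/n*n≡m (k![n∸k]!∣n! (ℕ.<⇒≤ k<p)))
  p∣C*k!*[p∸k]! : p ∣ (p C k) ℕ.* (k ! ℕ.* (p ∸ k) !)
  p∣C*k!*[p∸k]! = ≡.subst (p ∣_) (≡.sym p!) (p∣p! p (ℕ.<-trans 0<k k<p))
    where
    p∣p! : ∀ m → 0 < m → m ∣ m !
    p∣p! (suc m) _ = m∣m*n (m !)
... | inj₁ p∣C = p∣C
... | inj₂ p∣k!*[p∸k]! with euclidsLemma (k !) ((p ∸ k) !) p-prime p∣k!*[p∸k]!
...   | inj₁ p∣k!      = ⊥-elim (prime∤! p-prime k k<p p∣k!)
...   | inj₂ p∣[p∸k]!  = ⊥-elim (prime∤! p-prime (p ∸ k) (ℕ.∸-monoʳ-< {p} {k} {0} 0<k (ℕ.<⇒≤ k<p)) p∣[p∸k]!)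

record FinEnumeration {a} (m : ℕ) (Q : Fin m → Set a) : Set a where
  field
    size     : ℕ
    enum     : Fin size → Fin m
    enum-in  : ∀ i → Q (enum i)
    enum-inj : ∀ i j → enum i ≡ enum j → i ≡ j
    enum-sur : ∀ x → Q x → ∃ λ i → enum i ≡ x

finEnumeration : ∀ {a} m {Q : Fin m → Set a} → U.Decidable Q → FinEnumeration m Q
finEnumeration zero    Q? = record { size = 0 ; enum = λ () ; enum-in = λ () ; enum-inj = λ () ; enum-sur = λ () }
finEnumeration (suc m) {Q} Q? with finEnumeration m (λ i → Q? (suc i)) | Q? zero
... | E | yes Q0 = record
  { size = suc size ; enum = enum′ ; enum-in = enum′-in ; enum-inj = enum′-inj ; enum-sur = enum′-sur }
  where
  open FinEnumeration E
  enum′ : Fin (suc size) → Fin (suc m)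
  enum′ zero    = zero
  enum′ (suc i) = suc (enum i)
  enum′-in : ∀ i → Q (enum′ i)
  enum′-in zero    = Q0
  enum′-in (suc i) = enum-in i
  enum′-inj : ∀ i j → enum′ i ≡ enum′ j → i ≡ j
  enum′-inj zero    zero    _  = ≡.refl
  enum′-inj (suc i) (suc j) eq = ≡.cong suc (enum-inj i j (Fin.suc-injective eq))
  enum′-sur : ∀ x → Q x → ∃ λ i → enum′ i ≡ x
  enum′-sur zero    _  = zero , ≡.refl
  enum′-sur (suc x) Qx with enum-sur x Qx
  ... | i , eq = suc i , ≡.cong suc eq
... | E | no ¬Q0 = record
  { size = size ; enum = λ i → suc (enum i) ; enum-in = enum-in
  ; enum-inj = λ i j eq → enum-inj i j (Fin.suc-injective eq) ; enum-sur = enum′-sur }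
  where
  open FinEnumeration E
  enum′-sur : ∀ x → Q x → ∃ λ i → suc (enum i) ≡ x
  enum′-sur zero    Q0 = ⊥-elim (¬Q0 Q0)
  enum′-sur (suc x) Qx with enum-sur x Qx
  ... | i , eq = i , ≡.cong suc eq

module RingProperties {c ℓ} (R : CommutativeRing c ℓ) where
  open CommutativeRing R hiding (zero)
  open import Algebra.Properties.Semiring.Exp semiring using (_^_)
  open import Algebra.Properties.Semiring.Mult semiring using (×1-homo-*)
  open import Algebra.Properties.Monoid.Mult +-monoid using (×-homo-+)

  ι-+ : ∀ m n → ι R (m ℕ.+ n) ≈ ι R m + ι R n
  ι-+ = ×-homo-+ 1#

  ι-* : ∀ m n → ι R (m ℕ.* n) ≈ ι R m * ι R n
  ι-* = ×1-homo-*

  ι-^ : ∀ m n → ι R (m ℕ.^ n) ≈ ι R m ^ n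
  ι-^ m zero    = +-identityʳ 1#
  ι-^ m (suc n) = trans (ι-* m (m ℕ.^ n)) (*-congˡ (ι-^ m n))

  ι-1 : ι R 1 ≈ 1#
  ι-1 = +-identityʳ 1#

  0^n≈0 : ∀ {n} → 0 < n → 0# ^ n ≈ 0#
  0^n≈0 {suc n} _ = zeroˡ _

  1^n≈1 : ∀ n → 1# ^ n ≈ 1#
  1^n≈1 zero    = refl
  1^n≈1 (suc n) = trans (*-identityˡ _) (1^n≈1 n)

-- Polynomial functions are described through their difference quotients:
-- f has degree ≤ d + 1 when, at every point a, f x - f a = (x - a) * g x for
-- some g of degree ≤ d; no polynomial ring is needed for root counting.
module PolynomialFunctions {c ℓ} (R : CommutativeRing c ℓ) where
  open CommutativeRing R hiding (zero)
  open import Algebra.Properties.Semiring.Exp semiring using (_^_)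
  open import Algebra.Properties.Ring ring using (-‿distribʳ-*)
  open import Relation.Binary.Reasoning.Setoid setoid
  open IntegerCoefficientSolver R

  IsMonic : ℕ → (Carrier → Carrier) → Set (c ⊔ ℓ)
  IsMonic zero    f = ∀ x → f x ≈ 1#
  IsMonic (suc d) f = ∀ a → ∃ λ g → IsMonic d g × (∀ x → f x - f a ≈ (x - a) * g x)

  HasDegree≤ : ℕ → (Carrier → Carrier) → Set (c ⊔ ℓ)
  HasDegree≤ zero    f = ∃ λ k → ∀ x → f x ≈ k
  HasDegree≤ (suc d) f = ∀ a → ∃ λ g → HasDegree≤ d g × (∀ x → f x - f a ≈ (x - a) * g x)

  private
    -‿cong₂ : ∀ {u u′ v v′} → u ≈ u′ → v ≈ v′ → u′ - v′ ≈ u - v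
    -‿cong₂ u≈u′ v≈v′ = sym (+-cong u≈u′ (-‿cong v≈v′))

  IsMonic-resp : ∀ d {f f′} → (∀ x → f x ≈ f′ x) → IsMonic d f → IsMonic d f′
  IsMonic-resp zero    f≈f′ monic x = trans (sym (f≈f′ x)) (monic x)
  IsMonic-resp (suc d) f≈f′ monic a with monic a
  ... | g , g-monic , quot = g , g-monic , λ x → trans (-‿cong₂ (f≈f′ x) (f≈f′ a)) (quot x)

  IsMonic⇒HasDegree≤ : ∀ d {f} → IsMonic d f → HasDegree≤ d f
  IsMonic⇒HasDegree≤ zero    monic = 1# , monic
  IsMonic⇒HasDegree≤ (suc d) monic a with monic a
  ... | g , g-monic , quot = g , IsMonic⇒HasDegree≤ d g-monic , quot

  IsMonic-*x+ : ∀ d {g} → IsMonic d g → ∀ k → IsMonic (suc d) (λ x → x * g x + k)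
  IsMonic-*x+ zero {g} g≈1 k a = (λ _ → 1#) , (λ _ → refl) , λ x → begin
    (x * g x + k) - (a * g a + k)  ≈⟨ -‿cong₂ (+-congʳ (*-congˡ (g≈1 x))) (+-congʳ (*-congˡ (g≈1 a))) ⟨
    (x * 1# + k) - (a * 1# + k)    ≈⟨ solve 4 (λ x a k o → (x :* o :+ k) :- (a :* o :+ k) := (x :- a) :* o) refl x a k 1# ⟩
    (x - a) * 1#                   ∎
  IsMonic-*x+ (suc d) {g} monic k a with monic a
  ... | g′ , g′-monic , quot = (λ x → x * g′ x + g a) , IsMonic-*x+ d g′-monic (g a) , λ x → begin
    (x * g x + k) - (a * g a + k)         ≈⟨ solve 5 (λ x a k u v → (x :* u :+ k) :- (a :* v :+ k) := x :* (u :- v) :+ (x :- a) :* v) refl x a k (g x) (g a) ⟩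
    x * (g x - g a) + (x - a) * g a       ≈⟨ +-congʳ (*-congˡ (quot x)) ⟩
    x * ((x - a) * g′ x) + (x - a) * g a  ≈⟨ solve 4 (λ x a w v → x :* ((x :- a) :* w) :+ (x :- a) :* v := (x :- a) :* (x :* w :+ v)) refl x a (g′ x) (g a) ⟩
    (x - a) * (x * g′ x + g a)            ∎

  IsMonic-^ : ∀ n → IsMonic n (_^ n)
  IsMonic-^ zero    _ = refl
  IsMonic-^ (suc n) = IsMonic-resp (suc n) (λ x → +-identityʳ _) (IsMonic-*x+ n (IsMonic-^ n) 0#)

  IsMonic-+ : ∀ d e {f h} → IsMonic d f → HasDegree≤ e h → e < d → IsMonic d (λ x → f x + h x)
  IsMonic-+ (suc d) zero {f} {h} monic (k , h≈k) _ a with monic a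
  ... | g , g-monic , quot = g , g-monic , λ x → begin
    (f x + h x) - (f a + h a)  ≈⟨ -‿cong₂ (+-congˡ (h≈k x)) (+-congˡ (h≈k a)) ⟨
    (f x + k) - (f a + k)      ≈⟨ solve 3 (λ u v k → (u :+ k) :- (v :+ k) := u :- v) refl (f x) (f a) k ⟩
    f x - f a                  ≈⟨ quot x ⟩
    (x - a) * g x              ∎
  IsMonic-+ (suc d) (suc e) {f} {h} monic h-deg (s≤s e<d) a with monic a | h-deg a
  ... | g , g-monic , quot | g′ , g′-deg , quot′ =
    (λ x → g x + g′ x) , IsMonic-+ d e g-monic g′-deg e<d , λ x → begin
      (f x + h x) - (f a + h a)       ≈⟨ solve 4 (λ u v s t → (u :+ s) :- (v :+ t) := (u :- v) :+ (s :- t)) refl (f x) (f a) (h x) (h a) ⟩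
      (f x - f a) + (h x - h a)       ≈⟨ +-cong (quot x) (quot′ x) ⟩
      (x - a) * g x + (x - a) * g′ x  ≈⟨ distribˡ _ _ _ ⟨
      (x - a) * (g x + g′ x)          ∎

  HasDegree≤-neg : HasDegree≤ 1 (λ x → - x)
  HasDegree≤-neg a = (λ _ → - 1#) , (- 1# , λ _ → refl) , λ x → begin
    - x - - a           ≈⟨ solve 2 (λ x a → :- x :- :- a := :- (x :- a)) refl x a ⟩
    - (x - a)           ≈⟨ -‿cong (*-identityʳ _) ⟨
    - ((x - a) * 1#)    ≈⟨ -‿distribʳ-* _ _ ⟩
    (x - a) * - 1#      ∎

module FieldProperties {c ℓ} (F : CommutativeRing c ℓ) (isField : IsField F) where
  open CommutativeRing F hiding (zero)
  open IsField isField
  open import Algebra.Properties.Semiring.Exp semiring using (_^_)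
  open import Algebra.Properties.Ring ring using (-‿distribʳ-*)
  open import Algebra.Properties.Group +-group using (x∙y⁻¹≈ε⇒x≈y; x≈y⇒x∙y⁻¹≈ε)
  open import Relation.Binary.Reasoning.Setoid setoid
  open PolynomialFunctions F

  x*y≈0⇒y≈0 : ∀ {x y} → x ≉ 0# → x * y ≈ 0# → y ≈ 0#
  x*y≈0⇒y≈0 {x} {y} x≉0 xy≈0 with inv x x≉0
  ... | x⁻¹ , xx⁻¹≈1 = begin
    y                ≈⟨ *-identityˡ y ⟨
    1# * y           ≈⟨ *-congʳ (trans (sym xx⁻¹≈1) (*-comm x x⁻¹)) ⟩
    (x⁻¹ * x) * y    ≈⟨ *-assoc x⁻¹ x y ⟩
    x⁻¹ * (x * y)    ≈⟨ *-congˡ xy≈0 ⟩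
    x⁻¹ * 0#         ≈⟨ zeroʳ x⁻¹ ⟩
    0#               ∎

  *-≉0 : ∀ {x y} → x ≉ 0# → y ≉ 0# → x * y ≉ 0#
  *-≉0 x≉0 y≉0 xy≈0 = y≉0 (x*y≈0⇒y≈0 x≉0 xy≈0)

  ^-≉0 : ∀ {x} n → x ≉ 0# → x ^ n ≉ 0#
  ^-≉0 zero    _   = 1≉0
  ^-≉0 (suc n) x≉0 = *-≉0 x≉0 (^-≉0 n x≉0)

  *-cancelˡ : ∀ {x y z} → x ≉ 0# → x * y ≈ x * z → y ≈ z
  *-cancelˡ {x} {y} {z} x≉0 xy≈xz = x∙y⁻¹≈ε⇒x≈y y z (x*y≈0⇒y≈0 x≉0 (begin
    x * (y - z)       ≈⟨ distribˡ x y (- z) ⟩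
    x * y + x * - z   ≈⟨ +-congˡ (-‿distribʳ-* x z) ⟨
    x * y - x * z     ≈⟨ x≈y⇒x∙y⁻¹≈ε xy≈xz ⟩
    0#                ∎))

  IsMonic⇒¬[1+d]Roots : ∀ d {f} → IsMonic d f → (r : Fin (suc d) → Carrier) →
    (∀ i j → r i ≈ r j → i ≡ j) → ¬ (∀ i → f (r i) ≈ 0#)
  IsMonic⇒¬[1+d]Roots zero    f≈1   r _     roots = 1≉0 (trans (sym (f≈1 (r zero))) (roots zero))
  IsMonic⇒¬[1+d]Roots (suc d) {f} monic r r-inj roots with monic (r zero)
  ... | g , g-monic , quot = IsMonic⇒¬[1+d]Roots d g-monic (λ i → r (suc i))
          (λ i j eq → Fin.suc-injective (r-inj (suc i) (suc j) eq)) g-roots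
    where
    g-roots : ∀ i → g (r (suc i)) ≈ 0#
    g-roots i = x*y≈0⇒y≈0 r₁+i-r₀≉0 (begin
      (r (suc i) - r zero) * g (r (suc i))  ≈⟨ quot (r (suc i)) ⟨
      f (r (suc i)) - f (r zero)            ≈⟨ x≈y⇒x∙y⁻¹≈ε (trans (roots (suc i)) (sym (roots zero))) ⟩
      0#                                    ∎)
      where
      r₁+i-r₀≉0 : r (suc i) - r zero ≉ 0#
      r₁+i-r₀≉0 eq with r-inj (suc i) zero (x∙y⁻¹≈ε⇒x≈y _ _ eq)
      ... | ()

  roots≤degree : ∀ {P : Carrier → Set ℓ} {k} d {f} → IsMonic d f → SubsetHasCard F P k →
    (∀ x → P x → f x ≈ 0#) → k ≤ d
  roots≤degree {k = k} d monic card roots with d ℕ.<? k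
  ... | yes d<k = ⊥-elim (IsMonic⇒¬[1+d]Roots d monic (λ i → enum (Fin.inject≤ i d<k))
          (λ i j eq → Fin.inject≤-injective d<k d<k i j (enum-inj _ _ eq)) (λ i → roots _ (enum-in _)))
    where open SubsetHasCard card
  ... | no d≮k = ℕ.≮⇒≥ d≮k

module FiniteRing {c ℓ} (R : CommutativeRing c ℓ) {q} (card : HasCard R q) where
  open CommutativeRing R hiding (zero)
  open HasCard card
  open import Relation.Binary.Reasoning.Setoid setoid
  open import Algebra.Properties.Group +-group using (identityˡ-unique)
  private
    module ∑ = CommutativeMonoidSum +-commutativeMonoid
    module ∏ = CommutativeMonoidSum *-commutativeMonoid

  index : Carrier → Fin q
  index x = proj₁ (enum-sur x)

  enum-index : ∀ x → enum (index x) ≈ x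
  enum-index x = proj₂ (enum-sur x)

  index-cong : ∀ {x y} → x ≈ y → index x ≡ index y
  index-cong {x} {y} x≈y = enum-inj _ _ (trans (enum-index x) (trans x≈y (sym (enum-index y))))

  index-enum : ∀ i → index (enum i) ≡ i
  index-enum i = enum-inj _ _ (enum-index (enum i))

  _≟_ : Decidable _≈_
  x ≟ y with index x Fin.≟ index y
  ... | yes eq = yes (trans (sym (enum-index x)) (trans (reflexive (≡.cong enum eq)) (enum-index y)))
  ... | no  ne = no λ x≈y → ne (index-cong x≈y)

  module Reindex (f f⁻¹ : Carrier → Carrier)
                 (f-cong : ∀ {x y} → x ≈ y → f x ≈ f y) (f⁻¹-cong : ∀ {x y} → x ≈ y → f⁻¹ x ≈ f⁻¹ y)
                 (f∘f⁻¹ : ∀ x → f (f⁻¹ x) ≈ x) (f⁻¹∘f : ∀ x → f⁻¹ (f x) ≈ x) where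

    π : Permutation q q
    π = permutation (λ i → index (f (enum i))) (λ i → index (f⁻¹ (enum i))) (inverse f f⁻¹ f-cong f∘f⁻¹) (inverse f⁻¹ f f⁻¹-cong f⁻¹∘f)
      where
      inverse : ∀ g h → (∀ {x y} → x ≈ y → g x ≈ g y) → (∀ x → g (h x) ≈ x) →
        ∀ i → index (g (enum (index (h (enum i))))) ≡ i
      inverse g h g-cong g∘h i = ≡.trans (index-cong (trans (g-cong (enum-index _)) (g∘h (enum i)))) (index-enum i)

    ∑-reindex : (h : Carrier → Carrier) → (∀ {x y} → x ≈ y → h x ≈ h y) → ∑.sum {q} (λ i → h (enum i)) ≈ ∑.sum {q} (λ i → h (f (enum i)))
    ∑-reindex h h-cong = trans (∑.sum-permute (λ i → h (enum i)) π) (∑.sum-cong-≋ {q} λ i → h-cong (enum-index (f (enum i))))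

    ∏-reindex : (h : Carrier → Carrier) → (∀ {x y} → x ≈ y → h x ≈ h y) → ∏.sum {q} (λ i → h (enum i)) ≈ ∏.sum {q} (λ i → h (f (enum i)))
    ∏-reindex h h-cong = trans (∏.sum-permute (λ i → h (enum i)) π) (∏.sum-cong-≋ {q} λ i → h-cong (enum-index (f (enum i))))

  -- Translating every element by 1 leaves the sum of all elements unchanged.
  ι-card≈0 : ι R q ≈ 0#
  ι-card≈0 = identityˡ-unique (ι R q) (∑.sum enum) (sym (begin
    ∑.sum enum                       ≈⟨ Reindex.∑-reindex (λ x → 1# + x) (λ x → x - 1#) +-congˡ +-congʳ
                                          (λ x → solve 2 (λ o x → o :+ (x :- o) := x) refl 1# x)
                                          (λ x → solve 2 (λ o x → (o :+ x) :- o := x) refl 1# x) (λ x → x) (λ e → e) ⟩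
    ∑.sum {q} (λ i → 1# + enum i)    ≈⟨ ∑.∑-distrib-+ (λ _ → 1#) enum ⟩
    ∑.sum {q} (λ _ → 1#) + ∑.sum enum ≈⟨ +-congʳ (∑.sum-replicate q) ⟩
    ι R q + ∑.sum enum               ∎))
    where open IntegerCoefficientSolver R

  enumerate : ∀ {P : Carrier → Set ℓ} → U.Decidable P → (∀ {x y} → x ≈ y → P x → P y) → ∃ (SubsetHasCard R P)
  enumerate {P} P? P-resp = E.size , record
    { enum = λ i → enum (E.enum i) ; enum-in = E.enum-in
    ; enum-inj = λ i j eq → E.enum-inj i j (enum-inj _ _ eq) ; enum-sur = sur }
    where
    module E = FinEnumeration (finEnumeration q (λ i → P? (enum i)))
    sur : ∀ x → P x → ∃ λ i → enum (E.enum i) ≈ x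
    sur x Px with E.enum-sur (index x) (P-resp (sym (enum-index x)) Px)
    ... | i , eq = i , trans (reflexive (≡.cong enum eq)) (enum-index x)

module FiniteField {c ℓ} (F : CommutativeRing c ℓ) (isField : IsField F) {q} (card : HasCard F q) where
  open CommutativeRing F hiding (zero)
  open IsField isField
  open HasCard card
  open FieldProperties F isField
  open FiniteRing F card
  open import Algebra.Properties.Semiring.Exp semiring using (_^_; ^-congʳ)
  open import Relation.Binary.Reasoning.Setoid setoid
  private module ∏ = CommutativeMonoidSum *-commutativeMonoid

  ^-≈0⇒≈0 : ∀ {x} n → x ^ n ≈ 0# → x ≈ 0#
  ^-≈0⇒≈0 {x} n xⁿ≈0 with x ≟ 0#
  ... | yes x≈0 = x≈0
  ... | no  x≉0 = ⊥-elim (^-≉0 n x≉0 xⁿ≈0)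

  private
    nonzeroOr1 : Carrier → Carrier
    nonzeroOr1 y with y ≟ 0#
    ... | yes _ = 1#
    ... | no  _ = y

    nonzeroOr1-≉0 : ∀ y → nonzeroOr1 y ≉ 0#
    nonzeroOr1-≉0 y with y ≟ 0#
    ... | yes _   = 1≉0
    ... | no  y≉0 = y≉0

    nonzeroOr1-cong : ∀ {x y} → x ≈ y → nonzeroOr1 x ≈ nonzeroOr1 y
    nonzeroOr1-cong {x} {y} x≈y with x ≟ 0# | y ≟ 0#
    ... | yes _   | yes _   = refl
    ... | yes x≈0 | no  y≉0 = ⊥-elim (y≉0 (trans (sym x≈y) x≈0))
    ... | no  x≉0 | yes y≈0 = ⊥-elim (x≉0 (trans x≈y y≈0))
    ... | no  _   | no  _   = x≈y

    xIfNonzero : Carrier → Carrier → Carrier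
    xIfNonzero x y with y ≟ 0#
    ... | yes _ = 1#
    ... | no  _ = x

    nonzeroOr1-* : ∀ {x} y → x ≉ 0# → nonzeroOr1 (x * y) ≈ xIfNonzero x y * nonzeroOr1 y
    nonzeroOr1-* {x} y x≉0 with y ≟ 0# | (x * y) ≟ 0#
    ... | yes _   | yes _    = sym (*-identityˡ 1#)
    ... | yes y≈0 | no  xy≉0 = ⊥-elim (xy≉0 (trans (*-congˡ y≈0) (zeroʳ x)))
    ... | no  y≉0 | yes xy≈0 = ⊥-elim (*-≉0 x≉0 y≉0 xy≈0)
    ... | no  _   | no  _    = refl

  ∏-≉0 : ∀ {m} (h : Fin m → Carrier) → (∀ i → h i ≉ 0#) → ∏.sum h ≉ 0#
  ∏-≉0 {zero}  h _     = 1≉0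
  ∏-≉0 {suc m} h h≉0 = *-≉0 (h≉0 zero) (∏-≉0 (λ i → h (suc i)) (λ i → h≉0 (suc i)))

  ∏-constant-but-one : ∀ x {m} (z : Fin m) (h : Fin m → Carrier) →
    (∀ i → i ≢ z → h i ≈ x) → h z ≈ 1# → ∏.sum h ≈ x ^ (m ∸ 1)
  ∏-constant-but-one x {suc m} zero h h≈x hz≈1 = begin
    h zero * ∏.sum (λ i → h (suc i))  ≈⟨ *-cong hz≈1 (trans (∏.sum-cong-≋ {m} (λ i → h≈x (suc i) (λ ()))) (∏.sum-replicate m)) ⟩
    1# * x ^ m                         ≈⟨ *-identityˡ _ ⟩
    x ^ m                              ∎
  ∏-constant-but-one x {suc (suc m)} (suc z) h h≈x hz≈1 =
    *-cong (h≈x zero (λ ())) (∏-constant-but-one x z (λ i → h (suc i)) (λ i i≢z → h≈x (suc i) (λ eq → i≢z (Fin.suc-injective eq))) hz≈1)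

  -- Multiplication by x permutes the elements; comparing the products of their
  -- nonzero parts before and after gives x ^ (q - 1) = 1.
  x^[q-1]≈1 : ∀ {x} → x ≉ 0# → x ^ (q ∸ 1) ≈ 1#
  x^[q-1]≈1 {x} x≉0 with inv x x≉0
  ... | x⁻¹ , xx⁻¹≈1 = sym (begin
    1#  ≈⟨ *-cancelˡ (∏-≉0 _ (λ i → nonzeroOr1-≉0 (enum i))) Pxs ⟩
    Xs  ≈⟨ ∏-constant-but-one x (index 0#) (λ i → xIfNonzero x (enum i)) x-at-nonzero 1-at-0 ⟩
    x ^ (q ∸ 1) ∎)
    where
    Ps Xs : Carrier
    Ps = ∏.sum {q} (λ i → nonzeroOr1 (enum i))
    Xs = ∏.sum {q} (λ i → xIfNonzero x (enum i))
    x*[x⁻¹*y]≈y : ∀ y → x * (x⁻¹ * y) ≈ y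
    x*[x⁻¹*y]≈y y = trans (sym (*-assoc x x⁻¹ y)) (trans (*-congʳ xx⁻¹≈1) (*-identityˡ y))
    x⁻¹*[x*y]≈y : ∀ y → x⁻¹ * (x * y) ≈ y
    x⁻¹*[x*y]≈y y = trans (sym (*-assoc x⁻¹ x y)) (trans (*-congʳ (trans (*-comm x⁻¹ x) xx⁻¹≈1)) (*-identityˡ y))
    Pxs : Ps * 1# ≈ Ps * Xs
    Pxs = begin
      Ps * 1#                                                ≈⟨ *-identityʳ _ ⟩
      Ps                                                     ≈⟨ Reindex.∏-reindex (x *_) (x⁻¹ *_) *-congˡ *-congˡ x*[x⁻¹*y]≈y x⁻¹*[x*y]≈y nonzeroOr1 nonzeroOr1-cong ⟩
      ∏.sum {q} (λ i → nonzeroOr1 (x * enum i))              ≈⟨ ∏.sum-cong-≋ {q} (λ i → nonzeroOr1-* (enum i) x≉0) ⟩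
      ∏.sum {q} (λ i → xIfNonzero x (enum i) * nonzeroOr1 (enum i)) ≈⟨ ∏.∑-distrib-+ (λ i → xIfNonzero x (enum i)) (λ i → nonzeroOr1 (enum i)) ⟩
      Xs * Ps                                                ≈⟨ *-comm _ _ ⟩
      Ps * Xs                                                ∎
    x-at-nonzero : ∀ i → i ≢ index 0# → xIfNonzero x (enum i) ≈ x
    x-at-nonzero i i≢0 with enum i ≟ 0#
    ... | yes eᵢ≈0 = ⊥-elim (i≢0 (≡.trans (≡.sym (index-enum i)) (index-cong eᵢ≈0)))
    ... | no  _    = refl
    1-at-0 : xIfNonzero x (enum (index 0#)) ≈ 1#
    1-at-0 with enum (index 0#) ≟ 0#
    ... | yes _  = refl
    ... | no  ne = ⊥-elim (ne (enum-index 0#))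

  x^q≈x : ∀ x → x ^ q ≈ x
  x^q≈x x = trans (^-congʳ x q≡1+[q∸1]) (x*x^[q∸1]≈x (x ≟ 0#))
    where
    q≡1+[q∸1] : q ≡ suc (q ∸ 1)
    q≡1+[q∸1] = ≡.sym (ℕ.suc-pred q {{ℕ.>-nonZero (ℕ.≤-<-trans z≤n (Fin.toℕ<n (index x)))}})
    x*x^[q∸1]≈x : Dec (x ≈ 0#) → x * x ^ (q ∸ 1) ≈ x
    x*x^[q∸1]≈x (yes x≈0) = trans (*-congʳ x≈0) (trans (zeroˡ _) (sym x≈0))
    x*x^[q∸1]≈x (no  x≉0) = trans (*-congˡ (x^[q-1]≈1 x≉0)) (*-identityʳ x)

module FreshmansDream {c ℓ} (R : CommutativeRing c ℓ) where
  open CommutativeRing R hiding (zero)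
  open import Algebra.Properties.Semiring.Exp semiring using (_^_)
  open import Algebra.Properties.Semiring.Mult semiring using (×-assoc-*) renaming (_×_ to _·_)
  open import Algebra.Properties.Monoid.Mult +-monoid using (×-congʳ; ×-homo-1)
  open import Relation.Binary.Reasoning.Setoid setoid
  private module ∑ = MonoidSum +-monoid

  +-^-distrib : ∀ {P} x y → 1 < P → (∀ k → 0 < k → k < P → ι R (P C k) ≈ 0#) →
    (x + y) ^ P ≈ x ^ P + y ^ P
  +-^-distrib {suc zero}        _ _ (s≤s ()) _
  +-^-distrib {P@(suc (suc m))} x y _ middle≈0 = begin
    (x + y) ^ P                       ≈⟨ B.theorem (*-comm x y) P ⟩
    T 0 + ∑.sum {suc (suc m)} (λ i → T (Fin.toℕ (suc i)))
      ≈⟨ +-congˡ (∑.sum-init-last {suc m} (λ i → T (Fin.toℕ (suc i)))) ⟩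
    T 0 + (∑.sum {suc m} (λ i → T (Fin.toℕ (suc (Fin.inject₁ i)))) + T (Fin.toℕ (suc (Fin.fromℕ (suc m)))))
      ≈⟨ +-cong T0≈yᴾ (+-cong middle (reflexive (≡.cong (λ j → T (suc j)) (Fin.toℕ-fromℕ (suc m))))) ⟩
    y ^ P + (0# + T P)                ≈⟨ +-congˡ (trans (+-identityˡ _) TP≈xᴾ) ⟩
    y ^ P + x ^ P                     ≈⟨ +-comm _ _ ⟩
    x ^ P + y ^ P                     ∎
    where
    import Algebra.Properties.Semiring.Binomial semiring x y as B
    T : ℕ → Carrier
    T k = (P C k) · (x ^ k * y ^ (P ∸ k))
    T0≈yᴾ : T 0 ≈ y ^ P
    T0≈yᴾ = begin
      (P C 0) · (1# * y ^ P)  ≡⟨ ≡.cong (_· (1# * y ^ P)) (≡.trans (nCk≡nC[n∸k] {0} {P} z≤n) (nCn≡1 P)) ⟩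
      1 · (1# * y ^ P)        ≈⟨ ×-homo-1 _ ⟩
      1# * y ^ P              ≈⟨ *-identityˡ _ ⟩
      y ^ P                   ∎
    TP≈xᴾ : T P ≈ x ^ P
    TP≈xᴾ = begin
      (P C P) · (x ^ P * y ^ (P ∸ P))  ≡⟨ ≡.cong₂ (λ a b → a · (x ^ P * y ^ b)) (nCn≡1 P) (ℕ.n∸n≡0 P) ⟩
      1 · (x ^ P * 1#)                 ≈⟨ ×-homo-1 _ ⟩
      x ^ P * 1#                       ≈⟨ *-identityʳ _ ⟩
      x ^ P                            ∎
    Tk≈0 : ∀ k → 0 < k → k < P → T k ≈ 0#
    Tk≈0 k 0<k k<P = begin
      (P C k) · z         ≈⟨ ×-congʳ (P C k) (*-identityˡ z) ⟨
      (P C k) · (1# * z)  ≈⟨ ×-assoc-* (P C k) 1# z ⟨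
      ι R (P C k) * z     ≈⟨ *-congʳ (middle≈0 k 0<k k<P) ⟩
      0# * z              ≈⟨ zeroˡ z ⟩
      0#                  ∎
      where z = x ^ k * y ^ (P ∸ k)
    middle : ∑.sum {suc m} (λ i → T (Fin.toℕ (suc (Fin.inject₁ i)))) ≈ 0#
    middle = trans (∑.sum-cong-≋ {suc m} λ i → trans
                     (reflexive (≡.cong (λ j → T (suc j)) (Fin.toℕ-inject₁ i)))
                     (Tk≈0 (suc (Fin.toℕ i)) (s≤s z≤n) (s≤s (Fin.toℕ<n i))))
                   (∑.sum-replicate-zero (suc m))

module FrobeniusPowers {c ℓ} (R : CommutativeRing c ℓ) {p} (p-prime : Prime p) (ιp≈0 : CommutativeRing._≈_ R (ι R p) (CommutativeRing.0# R)) where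
  open CommutativeRing R hiding (zero)
  open RingProperties R
  open import Algebra.Properties.Semiring.Exp semiring using (_^_; ^-congˡ; ^-congʳ; ^-assocʳ)
  open import Algebra.Properties.CommutativeSemiring.Exp commutativeSemiring using (^-distrib-*)
  open import Algebra.Properties.Group +-group using (inverseʳ-unique)
  open import Relation.Binary.Reasoning.Setoid setoid
  open IntegerCoefficientSolver R

  p>0 : 0 < p
  p>0 = ℕ.<-trans (s≤s z≤n) (prime>1 p-prime)

  p∣⇒ι≈0 : ∀ {m} → p ∣ m → ι R m ≈ 0#
  p∣⇒ι≈0 (divides d ≡.refl) = trans (ι-* d p) (trans (*-congˡ ιp≈0) (zeroʳ _))

  frobenius-+ : ∀ x y → (x + y) ^ p ≈ x ^ p + y ^ p
  frobenius-+ x y = FreshmansDream.+-^-distrib R x y (prime>1 p-prime)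
    (λ k 0<k k<p → p∣⇒ι≈0 (prime∣pCk p-prime k 0<k k<p))

  ι^p≈ι : ∀ m → ι R m ^ p ≈ ι R m
  ι^p≈ι zero    = 0^n≈0 p>0
  ι^p≈ι (suc m) = trans (frobenius-+ 1# (ι R m)) (+-cong (1^n≈1 p) (ι^p≈ι m))

  σ : ℕ → Carrier → Carrier
  σ k x = x ^ (p ℕ.^ k)

  σ-cong : ∀ k {x y} → x ≈ y → σ k x ≈ σ k y
  σ-cong k = ^-congˡ (p ℕ.^ k)

  σ₀≈id : ∀ x → σ 0 x ≈ x
  σ₀≈id = *-identityʳ

  σ-+ℕ : ∀ a b x → σ (a ℕ.+ b) x ≈ σ b (σ a x)
  σ-+ℕ a b x = trans (^-congʳ x (ℕ.^-distribˡ-+-* p a b)) (sym (^-assocʳ x (p ℕ.^ a) (p ℕ.^ b)))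

  σ-comm : ∀ a b x → σ a (σ b x) ≈ σ b (σ a x)
  σ-comm a b x = trans (sym (σ-+ℕ b a x)) (trans (reflexive (≡.cong (λ k → σ k x) (ℕ.+-comm b a))) (σ-+ℕ a b x))

  σ-+ : ∀ k x y → σ k (x + y) ≈ σ k x + σ k y
  σ-+ zero    x y = trans (σ₀≈id _) (sym (+-cong (σ₀≈id x) (σ₀≈id y)))
  σ-+ (suc k) x y = begin
    σ (suc k) (x + y)            ≈⟨ σ-+ℕ 1 k (x + y) ⟩
    σ k (σ 1 (x + y))            ≈⟨ σ-cong k (trans (^-congʳ (x + y) (ℕ.*-identityʳ p)) (frobenius-+ x y)) ⟩
    σ k (x ^ p + y ^ p)          ≈⟨ σ-+ k _ _ ⟩
    σ k (x ^ p) + σ k (y ^ p)    ≈⟨ +-cong (σ-cong k (^-congʳ x (ℕ.*-identityʳ p))) (σ-cong k (^-congʳ y (ℕ.*-identityʳ p))) ⟨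
    σ k (σ 1 x) + σ k (σ 1 y)    ≈⟨ +-cong (σ-+ℕ 1 k x) (σ-+ℕ 1 k y) ⟨
    σ (suc k) x + σ (suc k) y    ∎

  σ-0# : ∀ k → σ k 0# ≈ 0#
  σ-0# k = 0^n≈0 (ℕ.m^n>0 p {{ℕ.>-nonZero p>0}} k)

  σ-neg : ∀ k x → σ k (- x) ≈ - σ k x
  σ-neg k x = inverseʳ-unique (σ k x) (σ k (- x))
    (trans (sym (σ-+ k x (- x))) (trans (σ-cong k (-‿inverseʳ x)) (σ-0# k)))

  σ-- : ∀ k x y → σ k (x - y) ≈ σ k x - σ k y
  σ-- k x y = trans (σ-+ k x (- y)) (+-congˡ (σ-neg k y))

  σ-* : ∀ k x y → σ k (x * y) ≈ σ k x * σ k y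
  σ-* k x y = ^-distrib-* x y (p ℕ.^ k)

  σ-1# : ∀ k → σ k 1# ≈ 1#
  σ-1# k = 1^n≈1 (p ℕ.^ k)

  σ-ι : ∀ k m → σ k (ι R m) ≈ ι R m
  σ-ι zero    m = σ₀≈id _
  σ-ι (suc k) m = trans (σ-+ℕ 1 k _) (trans (σ-cong k (trans (^-congʳ _ (ℕ.*-identityʳ p)) (ι^p≈ι m))) (σ-ι k m))

  Fixed : ℕ → Carrier → Set ℓ
  Fixed k x = σ k x ≈ x

  Fixed-resp : ∀ k {x y} → x ≈ y → Fixed k x → Fixed k y
  Fixed-resp k x≈y σx≈x = trans (σ-cong k (sym x≈y)) (trans σx≈x x≈y)

  Fixed-+ : ∀ {a b x} → Fixed a x → Fixed b x → Fixed (a ℕ.+ b) x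
  Fixed-+ {a} {b} {x} fa fb = trans (σ-+ℕ a b x) (trans (σ-cong b fa) fb)

  Fixed-∸ : ∀ {a b x} → Fixed a x → Fixed (a ℕ.+ b) x → Fixed b x
  Fixed-∸ {a} {b} {x} fa fab = trans (σ-cong b (sym fa)) (trans (sym (σ-+ℕ a b x)) fab)

  Fixed-* : ∀ {a x} t → Fixed a x → Fixed (a ℕ.* t) x
  Fixed-* {a} {x} zero    _  = trans (reflexive (≡.cong (λ k → σ k x) (ℕ.*-zeroʳ a))) (σ₀≈id x)
  Fixed-* {a} {x} (suc t) fa = ≡.subst (λ k → Fixed k x) (≡.sym (ℕ.*-suc a t)) (Fixed-+ {a} fa (Fixed-* {a} t fa))

  Fixed-bézout : ∀ {a b d s t x} → Fixed a x → Fixed b x → d ℕ.+ t ℕ.* b ≡ s ℕ.* a → Fixed d x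
  Fixed-bézout {a} {b} {d} {s} {t} {x} fa fb d+tb≡sa =
    Fixed-∸ {b ℕ.* t} (Fixed-* {b} t fb) (≡.subst (λ k → Fixed k x) as≡bt+d (Fixed-* {a} s fa))
    where
    as≡bt+d : a ℕ.* s ≡ b ℕ.* t ℕ.+ d
    as≡bt+d = ≡.trans (ℕ.*-comm a s) (≡.trans (≡.sym d+tb≡sa)
                (≡.trans (ℕ.+-comm d _) (≡.cong (ℕ._+ d) (ℕ.*-comm t b))))

  Fixed-gcd : ∀ {a b x} → Fixed a x → Fixed b x → Fixed (gcd a b) x
  Fixed-gcd {a} {b} fa fb with Bézout.identity (gcd-GCD a b)
  ... | Bézout.+- s t eq = Fixed-bézout {a} {b} {gcd a b} {s} {t} fa fb eq
  ... | Bézout.-+ s t eq = Fixed-bézout {b} {a} {gcd a b} {t} {s} fb fa eq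

  σ-translation : ∀ {k c e} → σ k c ≈ c + e → Fixed k e → ∀ t → σ (k ℕ.* t) c ≈ c + ι R t * e
  σ-translation {k} {c} {e} σc≈c+e fe zero = begin
    σ (k ℕ.* 0) c   ≡⟨ ≡.cong (λ j → σ j c) (ℕ.*-zeroʳ k) ⟩
    σ 0 c           ≈⟨ σ₀≈id c ⟩
    c               ≈⟨ solve 2 (λ c e → c := c :+ con (+ 0) :* e) refl c e ⟩
    c + 0# * e      ∎
  σ-translation {k} {c} {e} σc≈c+e fe (suc t) = begin
    σ (k ℕ.* suc t) c              ≡⟨ ≡.cong (λ j → σ j c) (ℕ.*-suc k t) ⟩
    σ (k ℕ.+ k ℕ.* t) c            ≈⟨ σ-+ℕ k (k ℕ.* t) c ⟩
    σ (k ℕ.* t) (σ k c)            ≈⟨ σ-cong (k ℕ.* t) σc≈c+e ⟩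
    σ (k ℕ.* t) (c + e)            ≈⟨ σ-+ (k ℕ.* t) c e ⟩
    σ (k ℕ.* t) c + σ (k ℕ.* t) e  ≈⟨ +-cong (σ-translation {k} σc≈c+e fe t) (Fixed-* {k} t fe) ⟩
    (c + ι R t * e) + e            ≈⟨ solve 3 (λ c i e → (c :+ i :* e) :+ e := c :+ (con (+ 1) :+ i) :* e) refl c (ι R t) e ⟩
    c + (ι R 1 + ι R t) * e        ≈⟨ +-congˡ (*-congʳ (+-congʳ ι-1)) ⟩
    c + (1# + ι R t) * e           ∎

module GaloisField {c ℓ} (F : CommutativeRing c ℓ) (isField : IsField F)
                   {p n} (p-prime : Prime p) (card : HasCard F (p ℕ.^ n)) where
  open CommutativeRing F hiding (zero)
  open IsField isField
  open HasCard card
  open RingProperties F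
  open FieldProperties F isField
  open FiniteRing F card
  open FiniteField F isField card
  open PolynomialFunctions F
  open import Algebra.Properties.Semiring.Exp semiring using (_^_)
  open import Algebra.Properties.Group +-group using (x∙y⁻¹≈ε⇒x≈y; x≈y⇒x∙y⁻¹≈ε)
  open import Relation.Binary.Reasoning.Setoid setoid
  open IntegerCoefficientSolver F

  ιp≈0 : ι F p ≈ 0#
  ιp≈0 = ^-≈0⇒≈0 n (trans (sym (ι-^ p n)) ι-card≈0)

  open FrobeniusPowers F p-prime ιp≈0 public

  Fixed-n : ∀ x → Fixed n x
  Fixed-n = x^q≈x

  σ-injective : ∀ k {x y} → σ k x ≈ σ k y → x ≈ y
  σ-injective k {x} {y} σx≈σy =
    x∙y⁻¹≈ε⇒x≈y x y (^-≈0⇒≈0 (p ℕ.^ k) (trans (σ-- k x y) (x≈y⇒x∙y⁻¹≈ε σx≈σy)))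

  private
    1+u≢v : ∀ {u v} → ι F u ≈ 0# → ι F v ≈ 0# → 1 ℕ.+ u ≢ v
    1+u≢v {u} ιu≈0 ιv≈0 ≡.refl = 1≉0 (begin
      1#              ≈⟨ +-identityʳ 1# ⟨
      1# + 0#         ≈⟨ +-congˡ ιu≈0 ⟨
      ι F (1 ℕ.+ u)   ≈⟨ ιv≈0 ⟩
      0#              ∎)

    ι-*-≈0 : ∀ y {m} → ι F m ≈ 0# → ι F (y ℕ.* m) ≈ 0#
    ι-*-≈0 y {m} ιm≈0 = trans (ι-* y m) (trans (*-congˡ ιm≈0) (zeroʳ _))

  coprime⇒ι≉0 : ∀ {m} → Coprime p m → ι F m ≉ 0#
  coprime⇒ι≉0 p⊥m ιm≈0 with coprime-Bézout p⊥m
  ... | Bézout.+- x y 1+ym≡xp = 1+u≢v (ι-*-≈0 y ιm≈0) (ι-*-≈0 x ιp≈0) 1+ym≡xp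
  ... | Bézout.-+ x y 1+xp≡ym = 1+u≢v (ι-*-≈0 x ιp≈0) (ι-*-≈0 y ιm≈0) 1+xp≡ym

  Fixed-isSubfield : ∀ g → IsSubfield F (Fixed g)
  Fixed-isSubfield g = record
    { resp   = Fixed-resp g
    ; has0   = σ-0# g
    ; has1   = σ-1# g
    ; +-cl   = λ {x} {y} fx fy → trans (σ-+ g x y) (+-cong fx fy)
    ; *-cl   = λ {x} {y} fx fy → trans (σ-* g x y) (*-cong fx fy)
    ; neg-cl = λ {x} fx → trans (σ-neg g x) (-‿cong fx)
    ; inv-cl = λ {x} {y} fx x≉0 xy≈1 → *-cancelˡ x≉0 (begin
        x * σ g y      ≈⟨ *-congʳ fx ⟨
        σ g x * σ g y  ≈⟨ σ-* g x y ⟨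
        σ g (x * y)    ≈⟨ σ-cong g xy≈1 ⟩
        σ g 1#         ≈⟨ σ-1# g ⟩
        1#             ≈⟨ xy≈1 ⟨
        x * y          ∎)
    }

  -- For g * (1 + T) = n, the additive map h = σ g - id has kernel Fixed g, and
  -- its image consists of roots of the trace σ 0 + σ g + ... + σ (g T), whose
  -- composite with h telescopes to σ n - id = 0.  Root counting bounds kernel and
  -- image by p ^ g and p ^ (g T); since their product is at least p ^ n, the
  -- kernel has exactly p ^ g elements.
  module FixedFieldCardinality {g T} (1≤g : 1 ≤ g) (g[1+T]≡n : g ℕ.* suc T ≡ n) where
    h : Carrier → Carrier
    h x = σ g x - x

    h-- : ∀ x y → h (x - y) ≈ h x - h y
    h-- x y = trans (+-congʳ (σ-- g x y))
      (solve 4 (λ A B x y → (A :- B) :- (x :- y) := (A :- x) :- (B :- y)) refl (σ g x) (σ g y) x y)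

    trace : ℕ → Carrier → Carrier
    trace zero    y = 0#
    trace (suc t) y = trace t y + σ (g ℕ.* t) y

    trace-cong : ∀ t {x y} → x ≈ y → trace t x ≈ trace t y
    trace-cong zero    _   = refl
    trace-cong (suc t) x≈y = +-cong (trace-cong t x≈y) (σ-cong (g ℕ.* t) x≈y)

    trace-monic : ∀ t → IsMonic (p ℕ.^ (g ℕ.* t)) (trace (suc t))
    trace-monic zero    = IsMonic-resp (p ℕ.^ (g ℕ.* 0)) (λ _ → sym (+-identityˡ _)) (IsMonic-^ _)
    trace-monic (suc t) = IsMonic-resp (p ℕ.^ (g ℕ.* suc t)) (λ _ → +-comm _ _)
      (IsMonic-+ _ _ (IsMonic-^ _) (IsMonic⇒HasDegree≤ _ (trace-monic t)) pᵍᵗ<pᵍ⁽¹⁺ᵗ⁾)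
      where
      pᵍᵗ<pᵍ⁽¹⁺ᵗ⁾ : p ℕ.^ (g ℕ.* t) < p ℕ.^ (g ℕ.* suc t)
      pᵍᵗ<pᵍ⁽¹⁺ᵗ⁾ = ℕ.^-monoʳ-< p (prime>1 p-prime)
        (≡.subst (g ℕ.* t <_) (≡.sym (ℕ.*-suc g t)) (ℕ.m<n+m (g ℕ.* t) 1≤g))

    trace∘h : ∀ t x → trace t (h x) ≈ σ (g ℕ.* t) x - x
    trace∘h zero    x = begin
      0#                 ≈⟨ -‿inverseʳ x ⟨
      x - x              ≈⟨ +-congʳ (σ₀≈id x) ⟨
      σ 0 x - x          ≡⟨ ≡.cong (λ k → σ k x - x) (ℕ.*-zeroʳ g) ⟨
      σ (g ℕ.* 0) x - x  ∎
    trace∘h (suc t) x = begin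
      trace t (h x) + σ (g ℕ.* t) (h x)                          ≈⟨ +-cong (trace∘h t x) (σ-- (g ℕ.* t) (σ g x) x) ⟩
      (σ (g ℕ.* t) x - x) + (σ (g ℕ.* t) (σ g x) - σ (g ℕ.* t) x) ≈⟨ solve 3 (λ A x B → (A :- x) :+ (B :- A) := B :- x) refl _ x _ ⟩
      σ (g ℕ.* t) (σ g x) - x                                    ≈⟨ +-congʳ (σ-+ℕ g (g ℕ.* t) x) ⟨
      σ (g ℕ.+ g ℕ.* t) x - x                                    ≡⟨ ≡.cong (λ k → σ k x - x) (ℕ.*-suc g t) ⟨
      σ (g ℕ.* suc t) x - x                                      ∎

    trace∘h≈0 : ∀ x → trace (suc T) (h x) ≈ 0#
    trace∘h≈0 x = trans (trace∘h (suc T) x)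
      (x≈y⇒x∙y⁻¹≈ε (≡.subst (λ k → Fixed k x) (≡.sym g[1+T]≡n) (x^q≈x x)))

    Image : Carrier → Set ℓ
    Image v = ∃ λ i → h (enum i) ≈ v

    kernel≤ : ∀ {k} → SubsetHasCard F (Fixed g) k → k ≤ p ℕ.^ g
    kernel≤ K = roots≤degree (p ℕ.^ g) h-monic K (λ _ → x≈y⇒x∙y⁻¹≈ε)
      where
      h-monic : IsMonic (p ℕ.^ g) h
      h-monic = IsMonic-+ (p ℕ.^ g) 1 (IsMonic-^ _) HasDegree≤-neg (ℕ.^-monoʳ-< p (prime>1 p-prime) 1≤g)

    image≤ : ∀ {m} → SubsetHasCard F Image m → m ≤ p ℕ.^ (g ℕ.* T)
    image≤ I = roots≤degree _ (trace-monic T) I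
      (λ { v (i , hᵢ≈v) → trans (trace-cong (suc T) (sym hᵢ≈v)) (trace∘h≈0 (enum i)) })

    -- x ↦ (x - r, h x), with r the enumerated preimage of h x, is injective.
    card≤kernel*image : ∀ {k m} → SubsetHasCard F (Fixed g) k → SubsetHasCard F Image m → p ℕ.^ n ≤ k ℕ.* m
    card≤kernel*image {k} {m} K I = Fin.injective⇒≤ {f = pair} (λ {i} {j} → pair-injective i j)
      where
      module K = SubsetHasCard K
      module I = SubsetHasCard I

      imageIndex : Fin (p ℕ.^ n) → Fin m
      imageIndex i = proj₁ (I.enum-sur (h (enum i)) (i , refl))

      preimage : Fin m → Carrier
      preimage t = enum (proj₁ (I.enum-in t))

      inKernel : ∀ i → Fixed g (enum i - preimage (imageIndex i))
      inKernel i = x∙y⁻¹≈ε⇒x≈y _ _ (begin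
        h (enum i - preimage (imageIndex i))      ≈⟨ h-- (enum i) (preimage (imageIndex i)) ⟩
        h (enum i) - h (preimage (imageIndex i))  ≈⟨ x≈y⇒x∙y⁻¹≈ε (sym (trans (proj₂ (I.enum-in _)) (proj₂ (I.enum-sur _ _)))) ⟩
        0#                                        ∎)

      kernelIndex : Fin (p ℕ.^ n) → Fin k
      kernelIndex i = proj₁ (K.enum-sur _ (inKernel i))

      pair : Fin (p ℕ.^ n) → Fin (k ℕ.* m)
      pair i = Fin.combine (kernelIndex i) (imageIndex i)

      pair-injective : ∀ i j → pair i ≡ pair j → i ≡ j
      pair-injective i j pairᵢ≡pairⱼ = enum-inj i j (begin
        enum i                    ≈⟨ solve 2 (λ a r → a := (a :- r) :+ r) refl (enum i) rᵢ ⟩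
        (enum i - rᵢ) + rᵢ        ≈⟨ +-cong differences (reflexive (≡.cong preimage (proj₂ same-indices))) ⟩
        (enum j - rⱼ) + rⱼ        ≈⟨ solve 2 (λ a r → (a :- r) :+ r := a) refl (enum j) rⱼ ⟩
        enum j                    ∎)
        where
        same-indices : kernelIndex i ≡ kernelIndex j × imageIndex i ≡ imageIndex j
        same-indices = Fin.combine-injective (kernelIndex i) (imageIndex i) (kernelIndex j) (imageIndex j) pairᵢ≡pairⱼ
        rᵢ rⱼ : Carrier
        rᵢ = preimage (imageIndex i)
        rⱼ = preimage (imageIndex j)
        differences : enum i - rᵢ ≈ enum j - rⱼ
        differences = trans (sym (proj₂ (K.enum-sur _ (inKernel i))))
          (trans (reflexive (≡.cong K.enum (proj₁ same-indices))) (proj₂ (K.enum-sur _ (inKernel j))))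

    kernel≡pᵍ : ∀ {k m} → SubsetHasCard F (Fixed g) k → SubsetHasCard F Image m → k ≡ p ℕ.^ g
    kernel≡pᵍ {k} {m} K I = ℕ.≤-antisym (kernel≤ K) (ℕ.≮⇒≥ λ k<pᵍ → ℕ.<-irrefl pⁿ≡pᵍpᵍᵀ
      (ℕ.≤-<-trans (ℕ.≤-trans (card≤kernel*image K I) (ℕ.*-monoʳ-≤ k (image≤ I)))
                   (ℕ.*-monoˡ-< (p ℕ.^ (g ℕ.* T)) {{ℕ.>-nonZero (ℕ.m^n>0 p {{ℕ.>-nonZero p>0}} (g ℕ.* T))}} k<pᵍ)))
      where
      pⁿ≡pᵍpᵍᵀ : p ℕ.^ n ≡ p ℕ.^ g ℕ.* p ℕ.^ (g ℕ.* T)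
      pⁿ≡pᵍpᵍᵀ = ≡.trans (≡.cong (p ℕ.^_) (≡.trans (≡.sym g[1+T]≡n) (ℕ.*-suc g T))) (ℕ.^-distribˡ-+-* p g (g ℕ.* T))

    Fixed-card : SubsetHasCard F (Fixed g) (p ℕ.^ g)
    Fixed-card with enumerate (λ x → σ g x ≟ x) (Fixed-resp g)
                  | enumerate (λ v → Fin.any? (λ i → h (enum i) ≟ v)) (λ v≈w (i , hᵢ≈v) → i , trans hᵢ≈v v≈w)
    ... | _ , K | _ , I = ≡.subst (SubsetHasCard F (Fixed g)) (kernel≡pᵍ K I) K

  Fixed-card : ∀ {g} → 1 ≤ g → g ∣ n → 0 < n → SubsetHasCard F (Fixed g) (p ℕ.^ g)
  Fixed-card {g} 1≤g (divides zero    n≡0)        0<n = ⊥-elim (ℕ.<⇒≢ 0<n (≡.sym n≡0))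
  Fixed-card {g} 1≤g (divides (suc T) n≡[1+T]g) _   =
    FixedFieldCardinality.Fixed-card 1≤g (≡.trans (ℕ.*-comm g (suc T)) (≡.sym n≡[1+T]g))

module ShiftedFrobenius {a ℓ} (F : CommutativeRing a ℓ) (isField : IsField F)
                        {p n} (p-prime : Prime p) (card : HasCard F (p ℕ.^ n))
                        (p⊥n : Coprime p n) (0<n : 0 < n) where
  open CommutativeRing F hiding (zero)
  open RingProperties F
  open FieldProperties F isField
  open GaloisField F isField {p} {n} p-prime card
  open import Algebra.Properties.Group +-group using (identityˡ-unique; identityʳ-unique; x∙y⁻¹≈ε⇒x≈y)
  open import Relation.Binary.Reasoning.Setoid setoid
  open IntegerCoefficientSolver F

  -- σ (k n) = id forces n e = 0, and n is invertible because p ∤ n.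
  translation-trivial : ∀ {k c e} → σ k c ≈ c + e → Fixed k e → e ≈ 0#
  translation-trivial {k} {c} {e} σc≈c+e fe =
    x*y≈0⇒y≈0 (coprime⇒ι≉0 p⊥n) (identityˡ-unique (ι F n * e) c (begin
      ι F n * e + c   ≈⟨ +-comm _ _ ⟩
      c + ι F n * e   ≈⟨ σ-translation {k} σc≈c+e fe n ⟨
      σ (k ℕ.* n) c   ≡⟨ ≡.cong (λ j → σ j c) (ℕ.*-comm k n) ⟩
      σ (n ℕ.* k) c   ≈⟨ Fixed-* {n} k (Fixed-n c) ⟩
      c               ∎))

  collision⇒fixed∧ι≈0 : ∀ {b i k} → ι F i + σ i b ≈ ι F (i ℕ.+ k) + σ (i ℕ.+ k) b →
    Fixed k (σ i b) × ι F k ≈ 0#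
  collision⇒fixed∧ι≈0 {b} {i} {k} collision = σₖc≈c , identityʳ-unique (ι F i) (ι F k) (sym ιi≈ιi+ιk)
    where
    c e : Carrier
    c = σ i b
    e = ι F i - ι F (i ℕ.+ k)
    σₖc≈c+e : σ k c ≈ c + e
    σₖc≈c+e = begin
      σ k c                               ≈⟨ solve 2 (λ a s → s := (a :+ s) :- a) refl (ι F (i ℕ.+ k)) (σ k c) ⟩
      (ι F (i ℕ.+ k) + σ k c) - ι F (i ℕ.+ k) ≈⟨ +-congʳ (trans collision (+-congˡ (σ-+ℕ i k b))) ⟨
      (ι F i + c) - ι F (i ℕ.+ k)         ≈⟨ solve 3 (λ a c b → (a :+ c) :- b := c :+ (a :- b)) refl (ι F i) c (ι F (i ℕ.+ k)) ⟩
      c + e                               ∎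
    e≈0 : e ≈ 0#
    e≈0 = translation-trivial {k} σₖc≈c+e (trans (σ-- k _ _) (+-cong (σ-ι k i) (-‿cong (σ-ι k (i ℕ.+ k)))))
    σₖc≈c : σ k c ≈ c
    σₖc≈c = trans σₖc≈c+e (trans (+-congˡ e≈0) (+-identityʳ c))
    ιi≈ιi+ιk : ι F i ≈ ι F i + ι F k
    ιi≈ιi+ιk = trans (x∙y⁻¹≈ε⇒x≈y _ _ e≈0) (ι-+ i k)

  ι-multiple-of-n≉0 : ∀ {k} → 0 < k → k < n ℕ.* p → n ∣ k → ι F k ≉ 0#
  ι-multiple-of-n≉0 {k} 0<k k<np (divides t k≡tn) ιk≈0 = coprime⇒ι≉0 (prime⇒coprime p-prime {{t≢0}} t<p) ιt≈0
    where
    t<p : t < p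
    t<p = ℕ.*-cancelʳ-< n t p (≡.subst₂ _<_ k≡tn (ℕ.*-comm n p) k<np)
    t≢0 : ℕ.NonZero t
    t≢0 = ℕ.≢-nonZero λ { ≡.refl → ℕ.<⇒≢ 0<k (≡.sym k≡tn) }
    ιt≈0 : ι F t ≈ 0#
    ιt≈0 = x*y≈0⇒y≈0 (coprime⇒ι≉0 p⊥n) (trans (*-comm _ _) (trans (sym (ι-* t n)) (trans (reflexive (≡.cong (ι F) (≡.sym k≡tn))) ιk≈0)))

  module _ (b : Carrier)
           (b∉subfields : ∀ m → m ∣ n → m < n → ∀ (S : Carrier → Set ℓ) →
                          IsSubfield F S → SubsetHasCard F S (p ℕ.^ m) → ¬ S b) where

    no-collision-at-distance : ∀ {i k} → 0 < k → i ℕ.+ k < n ℕ.* p →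
      ι F i + σ i b ≉ ι F (i ℕ.+ k) + σ (i ℕ.+ k) b
    no-collision-at-distance {i} {k} 0<k i+k<np collision =
      [ g≮n , g≢n ]′ (ℕ.m≤n⇒m<n∨m≡n g≤n)
      where
      σₖ-fixes×ιk≈0 : Fixed k (σ i b) × ι F k ≈ 0#
      σₖ-fixes×ιk≈0 = collision⇒fixed∧ι≈0 {b} {i} {k} collision
      g : ℕ
      g = gcd k n
      g∣n : g ∣ n
      g∣n = gcd[m,n]∣n k n
      g≤n : g ≤ n
      g≤n = ∣⇒≤ {{ℕ.>-nonZero 0<n}} g∣n
      1≤g : 1 ≤ g
      1≤g = ℕ.n≢0⇒n>0 (gcd[m,n]≢0 k n (inj₂ (ℕ.m<n⇒n≢0 0<n)))
      b-fixed : Fixed g b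
      b-fixed = σ-injective i (trans (σ-comm i g b) (Fixed-gcd {k} {n} (proj₁ σₖ-fixes×ιk≈0) (Fixed-n (σ i b))))
      g≮n : ¬ g < n
      g≮n g<n = b∉subfields g g∣n g<n (Fixed g) (Fixed-isSubfield g) (Fixed-card 1≤g g∣n 0<n) b-fixed
      k<np : k < n ℕ.* p
      k<np = ℕ.≤-<-trans (ℕ.m≤n+m k i) i+k<np
      g≢n : g ≢ n
      g≢n g≡n = ι-multiple-of-n≉0 0<k k<np (≡.subst (_∣ k) g≡n (gcd[m,n]∣m k n)) (proj₂ σₖ-fixes×ιk≈0)

    no-collision : ∀ {i j} → i < j → j ≤ n ℕ.* p ∸ 1 → ι F i + σ i b ≉ ι F j + σ j b
    no-collision {i} {j} i<j j≤np-1 =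
      ≡.subst (λ j → ι F i + σ i b ≉ ι F j + σ j b) i+[j∸i]≡j
        (no-collision-at-distance (ℕ.m<n⇒0<n∸m i<j) (≡.subst (_< n ℕ.* p) (≡.sym i+[j∸i]≡j) j<np))
      where
      i+[j∸i]≡j : i ℕ.+ (j ∸ i) ≡ j
      i+[j∸i]≡j = ℕ.m+[n∸m]≡n (ℕ.<⇒≤ i<j)
      j<np : j < n ℕ.* p
      j<np = ℕ.m≤pred[n]⇒suc[m]≤n
        {{ℕ.m*n≢0 n p {{ℕ.>-nonZero 0<n}} {{prime⇒nonZero p-prime}}}} j≤np-1

open import Data.Nat using (_*_; _^_)

mainTheorem5 : ∀ {c ℓ} (F : CommutativeRing c ℓ) → IsField F →
    (p n : ℕ) → Prime p → 2 < p → 1 ≤ n → Coprime p n →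
    HasCard F (p ^ n) →
    (b : CommutativeRing.Carrier F) →
    (∀ (m : ℕ) → m ∣ n → m < n →
      ∀ (S : CommutativeRing.Carrier F → Set ℓ) → IsSubfield F S → SubsetHasCard F S (p ^ m) →
      ¬ S b) →
    (i j : ℕ) → i ≤ n * p ∸ 1 → j ≤ n * p ∸ 1 → i ≢ j →
    ¬ CommutativeRing._≈_ F
        (CommutativeRing._+_ F (ι F i) (_^ᴿ_ F b (p ^ i)))
        (CommutativeRing._+_ F (ι F j) (_^ᴿ_ F b (p ^ j)))
mainTheorem5 F isField p n p-prime _ 0<n p⊥n card b b∉subfields i j i≤np-1 j≤np-1 i≢j collision =
  by-trichotomy (ℕ.<-cmp i j)
  where
  open ShiftedFrobenius F isField {p} {n} p-prime card p⊥n 0<n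
  by-trichotomy : Tri (i < j) (i ≡ j) (j < i) → ⊥
  by-trichotomy (tri< i<j _ _) = no-collision b b∉subfields i<j j≤np-1 collision
  by-trichotomy (tri≈ _ i≡j _) = i≢j i≡j
  by-trichotomy (tri> _ _ j<i) = no-collision b b∉subfields j<i i≤np-1 (CommutativeRing.sym F collision)
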